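{- Every $\mathcal{Q}(\mathrm{FO})$ formula is provably equivalent in $\mathsf{H}\mathsf{L}\mathsf{S}\mathsf{Q}$ to a $\mathcal{B}(\mathrm{FO})$ formula.
   Context: $\mathrm{FO}$: first-order formulas over a countable vocabulary $\tau$ with equality, built with $\neg,\to,\forall x$ over a countably infinite set of variables. $\mathcal{Q}(\mathrm{FO})$: closure of $\mathrm{FO}$ under $\sim$, $\rightarrowtail$ (material implication), $\multimap$ (linear implication), and the team quantifiers $\forall x$ and $!x$ for each variable $x$. $\mathcal{B}(\mathrm{FO})$: closure of $\mathrm{FO}$ under $\sim,\rightarrowtail$. Abbreviations: $\varphi\otimes\psi:=\sim(\varphi\multimap\sim\psi)$, $\varphi\sqcap\psi:=\sim(\varphi\rightarrowtail\sim\psi)$, $\varphi\bowtie\psi:=(\varphi\rightarrowtail\psi)\sqcap(\psi\rightarrowtail\varphi)$, $\exists x\varphi:=\sim!x\sim\varphi$. Provably equivalent: each derives the other. $\alpha,\beta,\gamma$ denote $\mathrm{FO}$ formulas, $\varphi,\psi,\vartheta$ arbitrary formulas. Derivations: finite sequences of premises, axiom instances, or rule conclusions; "theorem only" rules apply only to formulas derivable from no premises. $\mathsf{H}$: $\alpha\to(\beta\to\alpha)$; $(\alpha\to(\beta\to\gamma))\to((\alpha\to\beta)\to(\alpha\to\gamma))$; $(\neg\alpha\to\neg\beta)\to(\beta\to\alpha)$; $\forall x\alpha\to\alpha[x/t]$; $\forall x(\alpha\to\beta)\to(\alpha\to\forall x\beta)$ ($x$ not free in $\alpha$); $x=x$;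 $x=y\to(\alpha\to\alpha[x/y])$; modus ponens for $\to$; theorem-only universal generalization for $\mathrm{FO}$ formulas. $\mathsf{L}$: $\varphi\rightarrowtail(\psi\rightarrowtail\varphi)$; $(\varphi\rightarrowtail(\psi\rightarrowtail\vartheta))\rightarrowtail((\varphi\rightarrowtail\psi)\rightarrowtail(\varphi\rightarrowtail\vartheta))$; $(\sim\varphi\rightarrowtail\sim\psi)\rightarrowtail(\psi\rightarrowtail\varphi)$; $(\alpha\to\beta)\rightarrowtail(\alpha\rightarrowtail\beta)$; from $\varphi,\varphi\rightarrowtail\psi$ infer $\psi$. $\mathsf{S}$: $(\alpha\otimes\beta)\bowtie(\alpha\lor\beta)$; $\alpha\rightarrowtail(\varphi\multimap\alpha)$; $\varphi\rightarrowtail((\varphi\multimap\psi)\rightarrowtail(\vartheta\multimap\psi))$; $(\varphi\multimap(\psi\multimap\vartheta))\rightarrowtail(\psi\multimap(\varphi\multimap\vartheta))$; $(\varphi\multimap\sim\psi)\rightarrowtail(\psi\multimap\sim\varphi)$; $(\varphi\multimap(\psi\rightarrowtail\vartheta))\rightarrowtail((\varphi\multimap\psi)\rightarrowtail(\varphi\multimap\vartheta))$; theorem only: from $\varphi$ infer $\psi\multimap\varphi$. $\mathsf{Q}$: $\forall x\sim\varphi\bowtie\sim\forall x\varphi$; $\exists x\alpha\bowtie\neg\forall x\neg\alpha$; $\exists x(\varphi\otimes\psi)\bowtie(\exists x\varphi\otimes\exists x\psi)$; $\forall x\alpha\rightarrowtail!x\alpha$; $!x\psi\rightarrowtail\forall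 x\psi$; $\forall x(\varphi\rightarrowtail\psi)\rightarrowtail(\forall x\varphi\rightarrowtail\forall x\psi)$; $!x(\varphi\rightarrowtail\psi)\rightarrowtail(!x\varphi\rightarrowtail!x\psi)$; theorem only: from $\varphi$ infer $!x\varphi$. -}

module Defs where

open import Data.Nat using (ℕ; _≟_)
open import Data.Vec using (Vec; []; _∷_)
open import Data.List using (List; []; _∷_)
open import Data.List.Membership.Propositional using (_∈_)
open import Data.Product using (Σ; _×_; _,_)
open import Data.Sum using (_⊎_)
open import Data.Unit using (⊤)
open import Data.Empty using (⊥)
open import Function.Definitions using (Injective)
open import Relation.Nullary using (¬_; does)
open import Relation.Binary.PropositionalEquality using (_≡_; _≢_)
open import Data.Bool using (if_then_else_)

-- A countable vocabulary τ: function and relation symbols with arities,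
-- each set of symbols injecting into ℕ.
record Vocabulary : Set₁ where
  field
    Fun      : Set
    Rel      : Set
    funArity : Fun → ℕ
    relArity : Rel → ℕ
    funCode  : Fun → ℕ
    relCode  : Rel → ℕ
    funCode-inj : Injective _≡_ _≡_ funCode
    relCode-inj : Injective _≡_ _≡_ relCode

Var : Set
Var = ℕ

module Syntax (τ : Vocabulary) where
  open Vocabulary τ

  data Term : Set where
    var : Var → Term
    app : (f : Fun) → Vec Term (funArity f) → Term

  infixr 5 _⇒_
  data FO : Set where
    _≐_  : Term → Term → FO
    rel  : (R : Rel) → Vec Term (relArity R) → FO
    ¬ᶠ_  : FO → FO
    _⇒_  : FO → FO → FO
    ∀ᶠ   : Var → FO → FO

  _∨ᶠ_ : FO → FO → FO
  α ∨ᶠ β = (¬ᶠ α) ⇒ β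

  mutual
    OccT : Var → Term → Set
    OccT x (var y) = x ≡ y
    OccT x (app f ts) = OccTs x ts

    OccTs : ∀ {n} → Var → Vec Term n → Set
    OccTs x [] = ⊥
    OccTs x (t ∷ ts) = OccT x t ⊎ OccTs x ts

  FreeIn : Var → FO → Set
  FreeIn x (t ≐ u) = OccT x t ⊎ OccT x u
  FreeIn x (rel R ts) = OccTs x ts
  FreeIn x (¬ᶠ α) = FreeIn x α
  FreeIn x (α ⇒ β) = FreeIn x α ⊎ FreeIn x β
  FreeIn x (∀ᶠ y α) = (y ≢ x) × FreeIn x α

  FreeFor : Term → Var → FO → Set
  FreeFor t x (u ≐ v) = ⊤
  FreeFor t x (rel R ts) = ⊤
  FreeFor t x (¬ᶠ α) = FreeFor t x α
  FreeFor t x (α ⇒ β) = FreeFor t x α × FreeFor t x β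
  FreeFor t x (∀ᶠ y α) = (¬ FreeIn x (∀ᶠ y α)) ⊎ ((¬ OccT y t) × FreeFor t x α)

  mutual
    substT : Term → Var → Term → Term
    substT (var y) x t = if does (y ≟ x) then t else var y
    substT (app f us) x t = app f (substTs us x t)

    substTs : ∀ {n} → Vec Term n → Var → Term → Vec Term n
    substTs [] x t = []
    substTs (u ∷ us) x t = substT u x t ∷ substTs us x t

  _[_/_] : FO → Var → Term → FO
  (u ≐ v) [ x / t ] = substT u x t ≐ substT v x t
  rel R us [ x / t ] = rel R (substTs us x t)
  (¬ᶠ α) [ x / t ] = ¬ᶠ (α [ x / t ])
  (α ⇒ β) [ x / t ] = (α [ x / t ]) ⇒ (β [ x / t ])
  ∀ᶠ y α [ x / t ] = if does (y ≟ x) then ∀ᶠ y α else ∀ᶠ y (α [ x / t ])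

  -- FO formulas are embedded via `fo` below; the
  -- universal quantifier ∀x is shared between FO and the team level,
  -- so an FO formula ∀xα is represented as ∀̇ x (fo α).  Each Q(FO)
  -- formula has a unique representation.
  infixr 4 _↣_ _⊸_
  infix 3 _⋈_
  infixr 5 _⊗_ _⊓_
  infix 6 ∼_
  data Q : Set where
    eqQ  : Term → Term → Q
    relQ : (R : Rel) → Vec Term (relArity R) → Q
    negQ : FO → Q
    impQ : FO → FO → Q
    ∼_   : Q → Q
    _↣_  : Q → Q → Q
    _⊸_  : Q → Q → Q
    ∀̇    : Var → Q → Q
    !̇    : Var → Q → Q

  fo : FO → Q
  fo (t ≐ u) = eqQ t u
  fo (rel R ts) = relQ R ts
  fo (¬ᶠ α) = negQ α
  fo (α ⇒ β) = impQ α β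
  fo (∀ᶠ x α) = ∀̇ x (fo α)

  _⊗_ : Q → Q → Q
  φ ⊗ ψ = ∼ (φ ⊸ ∼ ψ)

  _⊓_ : Q → Q → Q
  φ ⊓ ψ = ∼ (φ ↣ ∼ ψ)

  _⋈_ : Q → Q → Q
  φ ⋈ ψ = (φ ↣ ψ) ⊓ (ψ ↣ φ)

  ∃̇ : Var → Q → Q
  ∃̇ x φ = ∼ (!̇ x (∼ φ))

  data IsB : Q → Set where
    isFO  : (α : FO) → IsB (fo α)
    isNeg : ∀ {φ} → IsB φ → IsB (∼ φ)
    isImp : ∀ {φ ψ} → IsB φ → IsB ψ → IsB (φ ↣ ψ)

  data _⊢_ (Γ : List Q) : Q → Set where
    premise : ∀ {φ} → φ ∈ Γ → Γ ⊢ φ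
    H1 : ∀ α β → Γ ⊢ fo (α ⇒ (β ⇒ α))
    H2 : ∀ α β γ → Γ ⊢ fo ((α ⇒ (β ⇒ γ)) ⇒ ((α ⇒ β) ⇒ (α ⇒ γ)))
    H3 : ∀ α β → Γ ⊢ fo ((¬ᶠ α ⇒ ¬ᶠ β) ⇒ (β ⇒ α))
    H4 : ∀ x α t → FreeFor t x α → Γ ⊢ fo (∀ᶠ x α ⇒ (α [ x / t ]))
    H5 : ∀ x α β → ¬ FreeIn x α → Γ ⊢ fo (∀ᶠ x (α ⇒ β) ⇒ (α ⇒ ∀ᶠ x β))
    H6 : ∀ x → Γ ⊢ fo (var x ≐ var x)
    H7 : ∀ x y α → FreeFor (var y) x α →
         Γ ⊢ fo ((var x ≐ var y) ⇒ (α ⇒ (α [ x / var y ])))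
    MP→ : ∀ {α β} → Γ ⊢ fo α → Γ ⊢ fo (α ⇒ β) → Γ ⊢ fo β
    UG  : ∀ {α} x → [] ⊢ fo α → Γ ⊢ fo (∀ᶠ x α)
    L1 : ∀ φ ψ → Γ ⊢ (φ ↣ (ψ ↣ φ))
    L2 : ∀ φ ψ ϑ → Γ ⊢ ((φ ↣ (ψ ↣ ϑ)) ↣ ((φ ↣ ψ) ↣ (φ ↣ ϑ)))
    L3 : ∀ φ ψ → Γ ⊢ ((∼ φ ↣ ∼ ψ) ↣ (ψ ↣ φ))
    L4 : ∀ α β → Γ ⊢ (fo (α ⇒ β) ↣ (fo α ↣ fo β))
    MP↣ : ∀ {φ ψ} → Γ ⊢ φ → Γ ⊢ (φ ↣ ψ) → Γ ⊢ ψ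
    S1 : ∀ α β → Γ ⊢ ((fo α ⊗ fo β) ⋈ fo (α ∨ᶠ β))
    S2 : ∀ α φ → Γ ⊢ (fo α ↣ (φ ⊸ fo α))
    S3 : ∀ φ ψ ϑ → Γ ⊢ (φ ↣ ((φ ⊸ ψ) ↣ (ϑ ⊸ ψ)))
    S4 : ∀ φ ψ ϑ → Γ ⊢ ((φ ⊸ (ψ ⊸ ϑ)) ↣ (ψ ⊸ (φ ⊸ ϑ)))
    S5 : ∀ φ ψ → Γ ⊢ ((φ ⊸ ∼ ψ) ↣ (ψ ⊸ ∼ φ))
    S6 : ∀ φ ψ ϑ → Γ ⊢ ((φ ⊸ (ψ ↣ ϑ)) ↣ ((φ ⊸ ψ) ↣ (φ ⊸ ϑ)))
    S7 : ∀ {φ} ψ → [] ⊢ φ → Γ ⊢ (ψ ⊸ φ)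
    Q1 : ∀ x φ → Γ ⊢ (∀̇ x (∼ φ) ⋈ ∼ (∀̇ x φ))
    Q2 : ∀ x α → Γ ⊢ (∃̇ x (fo α) ⋈ fo (¬ᶠ (∀ᶠ x (¬ᶠ α))))
    Q3 : ∀ x φ ψ → Γ ⊢ (∃̇ x (φ ⊗ ψ) ⋈ (∃̇ x φ ⊗ ∃̇ x ψ))
    Q4 : ∀ x α → Γ ⊢ (fo (∀ᶠ x α) ↣ !̇ x (fo α))
    Q5 : ∀ x ψ → Γ ⊢ (!̇ x ψ ↣ ∀̇ x ψ)
    Q6 : ∀ x φ ψ → Γ ⊢ (∀̇ x (φ ↣ ψ) ↣ (∀̇ x φ ↣ ∀̇ x ψ))
    Q7 : ∀ x φ ψ → Γ ⊢ (!̇ x (φ ↣ ψ) ↣ (!̇ x φ ↣ !̇ x ψ))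
    Q8 : ∀ {φ} x → [] ⊢ φ → Γ ⊢ (!̇ x φ)

  _⊣⊢_ : Q → Q → Set
  φ ⊣⊢ ψ = ((φ ∷ []) ⊢ ψ) × ((ψ ∷ []) ⊢ φ)

module Submission where

-- B(FO) is closed under ∼ and
-- ↣ by definition, and ∀x commutes into it because ∀x distributes over ∼
-- (axiom Q1) and over ↣ (axiom Q6 plus a case split).  The linear
-- connectives are rewritten as φ ⊸ ψ ≅ ∼(φ ⊗ ∼ψ) and !xφ ≅ ∼∃x∼φ, so it
-- remains to show that B(FO) is closed under ⊗ and ∃x.  For this every
-- B(FO) formula is brought into a disjunctive normal form whose disjuncts
-- are  α ∧ Some ε₁ ∧ … ∧ Some εₙ  with each εᵢ implying α, where
-- Some ε = ∼¬ε says that ε holds somewhere in the team.  The key lemma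
-- (conj≅tensor) identifies such a disjunct with the tensor product
-- Full ε₁ ⊗ … ⊗ Full εₙ ⊗ α; in that shape ⊗ and ∃x act componentwise
-- (axioms S1, Q2, Q3), while ∼ and ∧ act on the conjunctive shape.

open import Data.Bool using (true; false)
open import Data.List using (List; []; _∷_; _++_; map)
open import Data.List.Membership.Propositional using (_∈_)
open import Data.List.Relation.Binary.Subset.Propositional using (_⊆_)
open import Data.List.Relation.Unary.All as All using (All; []; _∷_)
open import Data.List.Relation.Unary.All.Properties using (++⁺; gmap⁺; map⁺)
open import Data.List.Relation.Unary.Any using (here; there)
open import Data.Nat using (_≡ᵇ_; _≟_)
open import Data.Nat.Properties using (≡ᵇ⇒≡)
open import Data.Product using (Σ; _×_; _,_; proj₁; proj₂)
open import Data.Sum using (inj₁; inj₂)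
open import Data.Unit using (tt)
open import Data.Vec using (Vec; []; _∷_)
open import Relation.Binary.PropositionalEquality using (_≡_; refl; sym; cong; cong₂; subst)
open import Relation.Nullary using (¬_; yes; no)
open import Defs

module Classical {F : Set} (_⟶_ : F → F → F) (~_ : F → F)
  (_⊩_ : List F → F → Set)
  (hyp : ∀ {Γ φ} → φ ∈ Γ → Γ ⊩ φ)
  (A1 : ∀ {Γ} φ ψ → Γ ⊩ (φ ⟶ (ψ ⟶ φ)))
  (A3 : ∀ {Γ} φ ψ → Γ ⊩ (((~ φ) ⟶ (~ ψ)) ⟶ (ψ ⟶ φ)))
  (mp : ∀ {Γ φ ψ} → Γ ⊩ φ → Γ ⊩ (φ ⟶ ψ) → Γ ⊩ ψ)
  (weakening : ∀ {Γ Δ φ} → Γ ⊆ Δ → Γ ⊩ φ → Δ ⊩ φ)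
  (deduction : ∀ {Γ φ ψ} → (φ ∷ Γ) ⊩ ψ → Γ ⊩ (φ ⟶ ψ))
  where

  infixr 9 _∙_
  infixr 4 _≅∘_

  private variable
    Γ : List F
    φ ψ χ θ : F

  h0 : (φ ∷ Γ) ⊩ φ
  h0 = hyp (here refl)

  h1 : (ψ ∷ φ ∷ Γ) ⊩ φ
  h1 = hyp (there (here refl))

  h2 : (χ ∷ ψ ∷ φ ∷ Γ) ⊩ φ
  h2 = hyp (there (there (here refl)))

  weaken : Γ ⊩ φ → (ψ ∷ Γ) ⊩ φ
  weaken = weakening there

  closed : [] ⊩ φ → Γ ⊩ φ
  closed = weakening (λ ())

  ⟶I : (φ ∷ Γ) ⊩ ψ → Γ ⊩ (φ ⟶ ψ)
  ⟶I = deduction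

  ⟶E : Γ ⊩ (φ ⟶ ψ) → Γ ⊩ φ → Γ ⊩ ψ
  ⟶E f a = mp a f

  ⟶-refl : Γ ⊩ (φ ⟶ φ)
  ⟶-refl = ⟶I h0

  _∙_ : Γ ⊩ (φ ⟶ ψ) → Γ ⊩ (ψ ⟶ χ) → Γ ⊩ (φ ⟶ χ)
  f ∙ g = ⟶I (⟶E (weaken g) (⟶E (weaken f) h0))

  dne : Γ ⊩ ((~ (~ φ)) ⟶ φ)
  dne {Γ = Γ} {φ = φ} = ⟶I (⟶E (⟶E (A3 φ (~ (~ φ))) shifted) h0)
    where
    -- from ~~φ: ~~~~φ ⟶ ~~φ by A1, contraposed twice with A3
    shifted : ((~ (~ φ)) ∷ Γ) ⊩ ((~ φ) ⟶ (~ (~ (~ φ))))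
    shifted = ⟶E (A3 (~ (~ (~ φ))) (~ φ)) (⟶E (A1 (~ (~ φ)) (~ (~ (~ (~ φ))))) h0)

  dni : Γ ⊩ (φ ⟶ (~ (~ φ)))
  dni {φ = φ} = ⟶E (A3 (~ (~ φ)) φ) dne

  contra : Γ ⊩ (φ ⟶ ψ) → Γ ⊩ ((~ ψ) ⟶ (~ φ))
  contra f = ⟶E (A3 _ _) (dne ∙ f ∙ dni)

  efq : Γ ⊩ (~ φ) → Γ ⊩ φ → Γ ⊩ ψ
  efq {φ = φ} {ψ = ψ} n p = ⟶E (⟶E (A3 ψ φ) (⟶E (A1 (~ φ) (~ ψ)) n)) p

  raa¬ : (φ ∷ Γ) ⊩ ψ → (φ ∷ Γ) ⊩ (~ ψ) → Γ ⊩ (~ φ)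
  raa¬ {φ = φ} {Γ = Γ} p n = ⟶E (⟶E (A3 (~ φ) (φ ⟶ φ)) absurd) ⟶-refl
    where
    absurd : Γ ⊩ ((~ (~ φ)) ⟶ (~ (φ ⟶ φ)))
    absurd = ⟶I (efq (⟶E (weaken (⟶I n)) (⟶E dne h0)) (⟶E (weaken (⟶I p)) (⟶E dne h0)))

  raa : ((~ φ) ∷ Γ) ⊩ ψ → ((~ φ) ∷ Γ) ⊩ (~ ψ) → Γ ⊩ φ
  raa p n = ⟶E dne (raa¬ p n)

  _∧_ : F → F → F
  φ ∧ ψ = ~ (φ ⟶ (~ ψ))

  _∨_ : F → F → F
  φ ∨ ψ = (~ φ) ⟶ ψ

  ∧I : Γ ⊩ φ → Γ ⊩ ψ → Γ ⊩ (φ ∧ ψ)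
  ∧I p q = raa¬ (weaken q) (⟶E h0 (weaken p))

  ∧E₁ : Γ ⊩ (φ ∧ ψ) → Γ ⊩ φ
  ∧E₁ c = raa (⟶I (efq h1 h0)) (weaken c)

  ∧E₂ : Γ ⊩ (φ ∧ ψ) → Γ ⊩ ψ
  ∧E₂ c = raa (⟶E (A1 _ _) h0) (weaken c)

  ∨I₁ : Γ ⊩ φ → Γ ⊩ (φ ∨ ψ)
  ∨I₁ p = ⟶I (efq h0 (weaken p))

  ∨I₂ : Γ ⊩ ψ → Γ ⊩ (φ ∨ ψ)
  ∨I₂ q = ⟶E (A1 _ _) q

  cases : Γ ⊩ (φ ⟶ χ) → Γ ⊩ ((~ φ) ⟶ χ) → Γ ⊩ χ
  cases f g = raa (⟶E (weaken g) (⟶E (contra (weaken f)) h0)) h0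

  ∨E : Γ ⊩ (φ ∨ ψ) → (φ ∷ Γ) ⊩ χ → (ψ ∷ Γ) ⊩ χ → Γ ⊩ χ
  ∨E d a b = cases (⟶I a) (d ∙ ⟶I b)

  ∧E₁⇒ : Γ ⊩ ((φ ∧ ψ) ⟶ φ)
  ∧E₁⇒ = ⟶I (∧E₁ h0)

  ∧E₂⇒ : Γ ⊩ ((φ ∧ ψ) ⟶ ψ)
  ∧E₂⇒ = ⟶I (∧E₂ h0)

  ∨I₁⇒ : Γ ⊩ (φ ⟶ (φ ∨ ψ))
  ∨I₁⇒ = ⟶I (∨I₁ h0)

  ∨I₂⇒ : Γ ⊩ (ψ ⟶ (φ ∨ ψ))
  ∨I₂⇒ = ⟶I (∨I₂ h0)

  ∨E⇒ : Γ ⊩ (φ ⟶ χ) → Γ ⊩ (ψ ⟶ χ) → Γ ⊩ ((φ ∨ ψ) ⟶ χ)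
  ∨E⇒ f g = ⟶I (∨E h0 (⟶E (weaken (weaken f)) h0) (⟶E (weaken (weaken g)) h0))

  _≅_ : F → F → Set
  φ ≅ ψ = ([] ⊩ (φ ⟶ ψ)) × ([] ⊩ (ψ ⟶ φ))

  ≅-refl : φ ≅ φ
  ≅-refl = ⟶-refl , ⟶-refl

  ≅-sym : φ ≅ ψ → ψ ≅ φ
  ≅-sym (a , b) = b , a

  _≅∘_ : φ ≅ ψ → ψ ≅ χ → φ ≅ χ
  (a , b) ≅∘ (c , d) = a ∙ c , d ∙ b

  ~-cong : φ ≅ ψ → (~ φ) ≅ (~ ψ)
  ~-cong (a , b) = contra b , contra a

  ⟶-cong : φ ≅ ψ → χ ≅ θ → (φ ⟶ χ) ≅ (ψ ⟶ θ)
  ⟶-cong (a , b) (c , d) = ⟶I (weaken b ∙ h0 ∙ weaken c) , ⟶I (weaken a ∙ h0 ∙ weaken d)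

  ∧-cong : φ ≅ ψ → χ ≅ θ → (φ ∧ χ) ≅ (ψ ∧ θ)
  ∧-cong p q = ~-cong (⟶-cong p (~-cong q))

  ∨-cong : φ ≅ ψ → χ ≅ θ → (φ ∨ χ) ≅ (ψ ∨ θ)
  ∨-cong p q = ⟶-cong (~-cong p) q

  ~~≅ : (~ (~ φ)) ≅ φ
  ~~≅ = dne , dni

  ∧-comm : (φ ∧ ψ) ≅ (ψ ∧ φ)
  ∧-comm = ⟶I (∧I (∧E₂ h0) (∧E₁ h0)) , ⟶I (∧I (∧E₂ h0) (∧E₁ h0))

  ∧-assoc : ((φ ∧ ψ) ∧ χ) ≅ (φ ∧ (ψ ∧ χ))
  ∧-assoc = ⟶I (∧I (∧E₁ (∧E₁ h0)) (∧I (∧E₂ (∧E₁ h0)) (∧E₂ h0)))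
          , ⟶I (∧I (∧I (∧E₁ h0) (∧E₁ (∧E₂ h0))) (∧E₂ (∧E₂ h0)))

  ∧-interchange : ((φ ∧ ψ) ∧ (χ ∧ θ)) ≅ ((φ ∧ χ) ∧ (ψ ∧ θ))
  ∧-interchange = ⟶I (∧I (∧I (∧E₁ (∧E₁ h0)) (∧E₁ (∧E₂ h0))) (∧I (∧E₂ (∧E₁ h0)) (∧E₂ (∧E₂ h0))))
                , ⟶I (∧I (∧I (∧E₁ (∧E₁ h0)) (∧E₁ (∧E₂ h0))) (∧I (∧E₂ (∧E₁ h0)) (∧E₂ (∧E₂ h0))))

  ∨-assoc : ((φ ∨ ψ) ∨ χ) ≅ (φ ∨ (ψ ∨ χ))
  ∨-assoc = ⟶I (∨E h0 (∨E h0 (∨I₁ h0) (∨I₂ (∨I₁ h0))) (∨I₂ (∨I₂ h0)))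
          , ⟶I (∨E h0 (∨I₁ (∨I₁ h0)) (∨E h0 (∨I₁ (∨I₂ h0)) (∨I₂ h0)))

  ∧-identityʳ : [] ⊩ ψ → (φ ∧ ψ) ≅ φ
  ∧-identityʳ t = ∧E₁⇒ , ⟶I (∧I h0 (closed t))

  ∨-identityˡ : [] ⊩ (~ φ) → (φ ∨ ψ) ≅ ψ
  ∨-identityˡ r = ⟶I (⟶E h0 (closed r)) , ∨I₂⇒

  ∨-identityʳ : [] ⊩ (~ ψ) → (φ ∨ ψ) ≅ φ
  ∨-identityʳ r = ⟶I (∨E h0 h0 (efq (closed r) h0)) , ∨I₁⇒

  ∧-zeroˡ : [] ⊩ (~ φ) → (φ ∧ ψ) ≅ φ
  ∧-zeroˡ r = ∧E₁⇒ , ⟶I (efq (closed r) h0)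

  ∧-zeroʳ : [] ⊩ (~ φ) → (ψ ∧ φ) ≅ φ
  ∧-zeroʳ r = ∧E₂⇒ , ⟶I (efq (closed r) h0)

  deMorgan-∧ : (~ (φ ∧ ψ)) ≅ ((~ φ) ∨ (~ ψ))
  deMorgan-∧ = ⟶I (⟶I (raa¬ (∧I (⟶E dne h1) h0) h2))
             , ⟶I (raa¬ (∨E h1 (efq h0 (∧E₁ h1)) (efq h0 (∧E₂ h1))) h0)

  deMorgan-∨ : (~ (φ ∨ ψ)) ≅ ((~ φ) ∧ (~ ψ))
  deMorgan-∨ = ⟶I (∧I (raa¬ (∨I₁ h0) h1) (raa¬ (∨I₂ h0) h1))
             , ⟶I (raa¬ (∨E h0 h0 (efq (∧E₂ h2) h0)) (∧E₁ h1))

  ∧-distribʳ-∨ : ((φ ∨ ψ) ∧ χ) ≅ ((φ ∧ χ) ∨ (ψ ∧ χ))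
  ∧-distribʳ-∨ = ⟶I (∨E (∧E₁ h0) (∨I₁ (∧I h0 (∧E₂ h1))) (∨I₂ (∧I h0 (∧E₂ h1))))
               , ⟶I (∨E h0 (∧I (∨I₁ (∧E₁ h0)) (∧E₂ h0)) (∧I (∨I₂ (∧E₁ h0)) (∧E₂ h0)))

  ∧-distribˡ-∨ : (χ ∧ (φ ∨ ψ)) ≅ ((χ ∧ φ) ∨ (χ ∧ ψ))
  ∧-distribˡ-∨ = ∧-comm ≅∘ ∧-distribʳ-∨ ≅∘ ∨-cong ∧-comm ∧-comm

  ⟶≅∨ : (φ ⟶ ψ) ≅ ((~ φ) ∨ ψ)
  ⟶≅∨ = ⟶I (⟶I (⟶E h1 (⟶E dne h0))) , ⟶I (⟶I (⟶E h1 (⟶E dni h0)))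

module Calculus (τ : Vocabulary) where
  open Syntax τ

  private variable
    Γ Δ : List Q
    φ ψ : Q

  weakening : Γ ⊆ Δ → Γ ⊢ φ → Δ ⊢ φ
  weakening ρ (premise p) = premise (ρ p)
  weakening ρ (H1 α β) = H1 α β
  weakening ρ (H2 α β γ) = H2 α β γ
  weakening ρ (H3 α β) = H3 α β
  weakening ρ (H4 x α t f) = H4 x α t f
  weakening ρ (H5 x α β f) = H5 x α β f
  weakening ρ (H6 x) = H6 x
  weakening ρ (H7 x y α f) = H7 x y α f
  weakening ρ (MP→ d e) = MP→ (weakening ρ d) (weakening ρ e)
  weakening ρ (UG x d) = UG x d
  weakening ρ (L1 a b) = L1 a b
  weakening ρ (L2 a b c) = L2 a b c
  weakening ρ (L3 a b) = L3 a b
  weakening ρ (L4 a b) = L4 a b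
  weakening ρ (MP↣ d e) = MP↣ (weakening ρ d) (weakening ρ e)
  weakening ρ (S1 a b) = S1 a b
  weakening ρ (S2 a b) = S2 a b
  weakening ρ (S3 a b c) = S3 a b c
  weakening ρ (S4 a b c) = S4 a b c
  weakening ρ (S5 a b) = S5 a b
  weakening ρ (S6 a b c) = S6 a b c
  weakening ρ (S7 a d) = S7 a d
  weakening ρ (Q1 x a) = Q1 x a
  weakening ρ (Q2 x a) = Q2 x a
  weakening ρ (Q3 x a b) = Q3 x a b
  weakening ρ (Q4 x a) = Q4 x a
  weakening ρ (Q5 x a) = Q5 x a
  weakening ρ (Q6 x a b) = Q6 x a b
  weakening ρ (Q7 x a b) = Q7 x a b
  weakening ρ (Q8 x d) = Q8 x d

  private
    ↣-refl : Γ ⊢ (φ ↣ φ)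
    ↣-refl {φ = φ} = MP↣ (L1 φ φ) (MP↣ (L1 φ (φ ↣ φ)) (L2 φ (φ ↣ φ) φ))

    ↣-const : Γ ⊢ ψ → Γ ⊢ (φ ↣ ψ)
    ↣-const d = MP↣ d (L1 _ _)

    ↣-app : ∀ {a b} → Γ ⊢ (φ ↣ (a ↣ b)) → Γ ⊢ (φ ↣ a) → Γ ⊢ (φ ↣ b)
    ↣-app f a = MP↣ a (MP↣ f (L2 _ _ _))

  -- Deduction theorem for ↣.  Rules whose side derivation is closed
  -- (UG, S7, Q8) ignore the premises, and MP→ is internalised by L4.
  deduction : (φ ∷ Γ) ⊢ ψ → Γ ⊢ (φ ↣ ψ)
  deduction (premise (here refl)) = ↣-refl
  deduction (premise (there p)) = ↣-const (premise p)
  deduction (H1 α β) = ↣-const (H1 α β)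
  deduction (H2 α β γ) = ↣-const (H2 α β γ)
  deduction (H3 α β) = ↣-const (H3 α β)
  deduction (H4 x α t f) = ↣-const (H4 x α t f)
  deduction (H5 x α β f) = ↣-const (H5 x α β f)
  deduction (H6 x) = ↣-const (H6 x)
  deduction (H7 x y α f) = ↣-const (H7 x y α f)
  deduction (MP→ {α} {β} d e) = ↣-app (↣-app (↣-const (L4 α β)) (deduction e)) (deduction d)
  deduction (UG x d) = ↣-const (UG x d)
  deduction (L1 a b) = ↣-const (L1 a b)
  deduction (L2 a b c) = ↣-const (L2 a b c)
  deduction (L3 a b) = ↣-const (L3 a b)
  deduction (L4 a b) = ↣-const (L4 a b)
  deduction (MP↣ d e) = ↣-app (deduction e) (deduction d)
  deduction (S1 a b) = ↣-const (S1 a b)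
  deduction (S2 a b) = ↣-const (S2 a b)
  deduction (S3 a b c) = ↣-const (S3 a b c)
  deduction (S4 a b c) = ↣-const (S4 a b c)
  deduction (S5 a b) = ↣-const (S5 a b)
  deduction (S6 a b c) = ↣-const (S6 a b c)
  deduction (S7 a d) = ↣-const (S7 a d)
  deduction (Q1 x a) = ↣-const (Q1 x a)
  deduction (Q2 x a) = ↣-const (Q2 x a)
  deduction (Q3 x a b) = ↣-const (Q3 x a b)
  deduction (Q4 x a) = ↣-const (Q4 x a)
  deduction (Q5 x a) = ↣-const (Q5 x a)
  deduction (Q6 x a b) = ↣-const (Q6 x a b)
  deduction (Q7 x a b) = ↣-const (Q7 x a b)
  deduction (Q8 x d) = ↣-const (Q8 x d)

  module QP = Classical _↣_ ∼_ _⊢_ premise L1 L3 MP↣ weakening deduction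

  -- The first-order fragment: axioms H1–H6 with premises among FO
  -- formulas.  Unlike HLSQ it has a deduction theorem for →, so
  -- first-order reasoning is done here and then embedded.
  data _⊢ᶠ_ (Σ₀ : List FO) : FO → Set where
    premiseᶠ : ∀ {α} → α ∈ Σ₀ → Σ₀ ⊢ᶠ α
    H1ᶠ : ∀ α β → Σ₀ ⊢ᶠ (α ⇒ (β ⇒ α))
    H2ᶠ : ∀ α β γ → Σ₀ ⊢ᶠ ((α ⇒ (β ⇒ γ)) ⇒ ((α ⇒ β) ⇒ (α ⇒ γ)))
    H3ᶠ : ∀ α β → Σ₀ ⊢ᶠ ((¬ᶠ α ⇒ ¬ᶠ β) ⇒ (β ⇒ α))
    H4ᶠ : ∀ x α t → FreeFor t x α → Σ₀ ⊢ᶠ (∀ᶠ x α ⇒ (α [ x / t ]))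
    H5ᶠ : ∀ x α β → ¬ FreeIn x α → Σ₀ ⊢ᶠ (∀ᶠ x (α ⇒ β) ⇒ (α ⇒ ∀ᶠ x β))
    H6ᶠ : ∀ x → Σ₀ ⊢ᶠ (var x ≐ var x)
    MPᶠ : ∀ {α β} → Σ₀ ⊢ᶠ α → Σ₀ ⊢ᶠ (α ⇒ β) → Σ₀ ⊢ᶠ β
    UGᶠ : ∀ {α} x → [] ⊢ᶠ α → Σ₀ ⊢ᶠ (∀ᶠ x α)

  private variable
    Σ₁ Σ₂ : List FO
    α β : FO

  weakeningᶠ : Σ₁ ⊆ Σ₂ → Σ₁ ⊢ᶠ α → Σ₂ ⊢ᶠ α
  weakeningᶠ ρ (premiseᶠ p) = premiseᶠ (ρ p)
  weakeningᶠ ρ (H1ᶠ a b) = H1ᶠ a b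
  weakeningᶠ ρ (H2ᶠ a b c) = H2ᶠ a b c
  weakeningᶠ ρ (H3ᶠ a b) = H3ᶠ a b
  weakeningᶠ ρ (H4ᶠ x a t f) = H4ᶠ x a t f
  weakeningᶠ ρ (H5ᶠ x a b f) = H5ᶠ x a b f
  weakeningᶠ ρ (H6ᶠ x) = H6ᶠ x
  weakeningᶠ ρ (MPᶠ d e) = MPᶠ (weakeningᶠ ρ d) (weakeningᶠ ρ e)
  weakeningᶠ ρ (UGᶠ x d) = UGᶠ x d

  private
    ⇒-refl : Σ₁ ⊢ᶠ (α ⇒ α)
    ⇒-refl {α = α} = MPᶠ (H1ᶠ α α) (MPᶠ (H1ᶠ α (α ⇒ α)) (H2ᶠ α (α ⇒ α) α))

    ⇒-const : Σ₁ ⊢ᶠ β → Σ₁ ⊢ᶠ (α ⇒ β)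
    ⇒-const d = MPᶠ d (H1ᶠ _ _)

    ⇒-app : ∀ {a b} → Σ₁ ⊢ᶠ (α ⇒ (a ⇒ b)) → Σ₁ ⊢ᶠ (α ⇒ a) → Σ₁ ⊢ᶠ (α ⇒ b)
    ⇒-app f a = MPᶠ a (MPᶠ f (H2ᶠ _ _ _))

  deductionᶠ : (α ∷ Σ₁) ⊢ᶠ β → Σ₁ ⊢ᶠ (α ⇒ β)
  deductionᶠ (premiseᶠ (here refl)) = ⇒-refl
  deductionᶠ (premiseᶠ (there p)) = ⇒-const (premiseᶠ p)
  deductionᶠ (H1ᶠ a b) = ⇒-const (H1ᶠ a b)
  deductionᶠ (H2ᶠ a b c) = ⇒-const (H2ᶠ a b c)
  deductionᶠ (H3ᶠ a b) = ⇒-const (H3ᶠ a b)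
  deductionᶠ (H4ᶠ x a t f) = ⇒-const (H4ᶠ x a t f)
  deductionᶠ (H5ᶠ x a b f) = ⇒-const (H5ᶠ x a b f)
  deductionᶠ (H6ᶠ x) = ⇒-const (H6ᶠ x)
  deductionᶠ (MPᶠ d e) = ⇒-app (deductionᶠ e) (deductionᶠ d)
  deductionᶠ (UGᶠ x d) = ⇒-const (UGᶠ x d)

  module FP = Classical _⇒_ ¬ᶠ_ _⊢ᶠ_ premiseᶠ H1ᶠ H3ᶠ MPᶠ weakeningᶠ deductionᶠ

  embed : [] ⊢ᶠ α → Γ ⊢ fo α
  embed (H1ᶠ a b) = H1 a b
  embed (H2ᶠ a b c) = H2 a b c
  embed (H3ᶠ a b) = H3 a b
  embed (H4ᶠ x a t f) = H4 x a t f
  embed (H5ᶠ x a b f) = H5 x a b f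
  embed (H6ᶠ x) = H6 x
  embed (MPᶠ d e) = MP→ (embed d) (embed e)
  embed (UGᶠ x d) = UG x (embed d)

  foImp : [] ⊢ᶠ (α ⇒ β) → Γ ⊢ (fo α ↣ fo β)
  foImp d = MP↣ (embed d) (L4 _ _)

  foImp₂ : ∀ {γ} → [] ⊢ᶠ (α ⇒ (β ⇒ γ)) → Γ ⊢ (fo α ↣ (fo β ↣ fo γ))
  foImp₂ {β = β} {γ = γ} d = QP._∙_ (foImp d) (L4 β γ)

  ⊤ᶠ : FO
  ⊤ᶠ = ∀ᶠ 0 (var 0 ≐ var 0)

  ⊥ᶠ : FO
  ⊥ᶠ = ¬ᶠ ⊤ᶠ

  ∃ᶠ : Var → FO → FO
  ∃ᶠ x α = ¬ᶠ (∀ᶠ x (¬ᶠ α))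

  _∧ᶠ_ : FO → FO → FO
  α ∧ᶠ β = ¬ᶠ (α ⇒ ¬ᶠ β)

  ⊢⊤ᶠ : [] ⊢ᶠ ⊤ᶠ
  ⊢⊤ᶠ = UGᶠ 0 (H6ᶠ 0)

  ⊢¬⊥ᶠ : [] ⊢ᶠ (¬ᶠ ⊥ᶠ)
  ⊢¬⊥ᶠ = FP.⟶E FP.dni ⊢⊤ᶠ

  -- Substituting a variable for itself is the identity; this turns H4
  -- into ∀-elimination.
  mutual
    substT-id : ∀ t x → substT t x (var x) ≡ t
    substT-id (var y) x with y ≡ᵇ x | ≡ᵇ⇒≡ y x
    ... | true  | y≡x = cong var (sym (y≡x tt))
    ... | false | _   = refl
    substT-id (app f ts) x = cong (app f) (substTs-id ts x)

    substTs-id : ∀ {n} (ts : Vec Term n) x → substTs ts x (var x) ≡ ts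
    substTs-id [] x = refl
    substTs-id (t ∷ ts) x = cong₂ _∷_ (substT-id t x) (substTs-id ts x)

  subst-id : ∀ α x → α [ x / var x ] ≡ α
  subst-id (t ≐ u) x = cong₂ _≐_ (substT-id t x) (substT-id u x)
  subst-id (rel R ts) x = cong (rel R) (substTs-id ts x)
  subst-id (¬ᶠ α) x = cong ¬ᶠ_ (subst-id α x)
  subst-id (α ⇒ β) x = cong₂ _⇒_ (subst-id α x) (subst-id β x)
  subst-id (∀ᶠ y α) x with y ≡ᵇ x
  ... | true  = refl
  ... | false = cong (∀ᶠ y) (subst-id α x)

  freeFor-self : ∀ α x → FreeFor (var x) x α
  freeFor-self (t ≐ u) x = tt
  freeFor-self (rel R ts) x = tt
  freeFor-self (¬ᶠ α) x = freeFor-self α x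
  freeFor-self (α ⇒ β) x = freeFor-self α x , freeFor-self β x
  freeFor-self (∀ᶠ y α) x with y ≟ x
  ... | yes refl = inj₁ (λ { (y≢y , _) → y≢y refl })
  ... | no y≢x = inj₂ (y≢x , freeFor-self α x)

  ∀-elimᶠ : ∀ x α → [] ⊢ᶠ (∀ᶠ x α ⇒ α)
  ∀-elimᶠ x α = subst (λ β → [] ⊢ᶠ (∀ᶠ x α ⇒ β)) (subst-id α x) (H4ᶠ x α (var x) (freeFor-self α x))

  ∀-monoᶠ : ∀ x → [] ⊢ᶠ (α ⇒ β) → [] ⊢ᶠ (∀ᶠ x α ⇒ ∀ᶠ x β)
  ∀-monoᶠ {α = α} {β = β} x d =
    MPᶠ (UGᶠ x (FP._∙_ (∀-elimᶠ x α) d)) (H5ᶠ x (∀ᶠ x α) β (λ { (x≢x , _) → x≢x refl }))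

  ∃-monoᶠ : ∀ x → [] ⊢ᶠ (α ⇒ β) → [] ⊢ᶠ (∃ᶠ x α ⇒ ∃ᶠ x β)
  ∃-monoᶠ x d = FP.contra (∀-monoᶠ x (FP.contra d))

  ⊥ᶠ-closed : ∀ x → ¬ FreeIn x ⊥ᶠ
  ⊥ᶠ-closed x (0≢x , inj₁ x≡0) = 0≢x (sym x≡0)
  ⊥ᶠ-closed x (0≢x , inj₂ x≡0) = 0≢x (sym x≡0)

  ⊥ᶠ⇒∀⊥ᶠ : ∀ x → [] ⊢ᶠ (⊥ᶠ ⇒ ∀ᶠ x ⊥ᶠ)
  ⊥ᶠ⇒∀⊥ᶠ x = MPᶠ (UGᶠ x FP.⟶-refl) (H5ᶠ x ⊥ᶠ ⊥ᶠ (⊥ᶠ-closed x))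

  ∃⊥ᶠ⇒⊥ᶠ : ∀ x → [] ⊢ᶠ (∃ᶠ x ⊥ᶠ ⇒ ⊥ᶠ)
  ∃⊥ᶠ⇒⊥ᶠ x = FP.⟶I (FP.efq FP.h0 (FP.closed (UGᶠ x ⊢¬⊥ᶠ)))

module NormalForm (τ : Vocabulary) where
  open Syntax τ
  open Calculus τ
  open QP

  private variable
    Γ : List Q
    φ ψ χ θ A B C X Y Z : Q
    α β γ ε : FO

  ⋈⇒≅ : [] ⊢ (φ ⋈ ψ) → φ ≅ ψ
  ⋈⇒≅ p = ∧E₁ p , ∧E₂ p

  ≅⇒⊣⊢ : φ ≅ ψ → φ ⊣⊢ ψ
  ≅⇒⊣⊢ (f , g) = ⟶E (closed f) h0 , ⟶E (closed g) h0

  module Modality (□ : Q → Q)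
    (K : ∀ {Γ} φ ψ → Γ ⊢ (□ (φ ↣ ψ) ↣ (□ φ ↣ □ ψ)))
    (N : ∀ {Γ φ} → [] ⊢ φ → Γ ⊢ □ φ) where

    ◇ : Q → Q
    ◇ φ = ∼ □ (∼ φ)

    □-mp : [] ⊢ (φ ↣ ψ) → Γ ⊢ □ φ → Γ ⊢ □ ψ
    □-mp d p = ⟶E (⟶E (K _ _) (N d)) p

    □-mp₂ : [] ⊢ (φ ↣ (ψ ↣ χ)) → Γ ⊢ □ φ → Γ ⊢ □ ψ → Γ ⊢ □ χ
    □-mp₂ d p q = ⟶E (⟶E (K _ _) (□-mp d p)) q

    □-mono : [] ⊢ (φ ↣ ψ) → Γ ⊢ (□ φ ↣ □ ψ)
    □-mono d = ⟶I (□-mp d h0)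

    ◇-mono : [] ⊢ (φ ↣ ψ) → Γ ⊢ (◇ φ ↣ ◇ ψ)
    ◇-mono d = contra (□-mono (contra d))

    □-cong : φ ≅ ψ → □ φ ≅ □ ψ
    □-cong (a , b) = □-mono a , □-mono b

    ◇-cong : φ ≅ ψ → ◇ φ ≅ ◇ ψ
    ◇-cong (a , b) = ◇-mono a , ◇-mono b

    ◇-distrib-∨ : ◇ (φ ∨ ψ) ≅ (◇ φ ∨ ◇ ψ)
    ◇-distrib-∨ {φ} {ψ} = ⟶I (⟶I (raa¬ (□-mp₂ both (⟶E dne h1) h0) h2))
                        , ∨E⇒ (◇-mono ∨I₁⇒) (◇-mono ∨I₂⇒)
      where
      both : [] ⊢ ((∼ φ) ↣ ((∼ ψ) ↣ (∼ (φ ∨ ψ))))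
      both = ⟶I (⟶I (raa¬ (⟶E h0 h2) h1))

    □◇⇒◇∧ : Γ ⊢ ((□ φ ∧ ◇ ψ) ↣ ◇ (φ ∧ ψ))
    □◇⇒◇∧ {φ = φ} {ψ = ψ} = ⟶I (raa¬ (□-mp₂ pair (∧E₁ h1) h0) (∧E₂ h1))
      where
      pair : [] ⊢ (φ ↣ ((∼ (φ ∧ ψ)) ↣ (∼ ψ)))
      pair = ⟶I (⟶I (raa¬ (∧I h2 h0) h1))

    ◇-refutable : [] ⊢ (∼ χ) → Γ ⊢ (◇ χ ↣ θ)
    ◇-refutable r = ⟶I (efq h0 (N r))

  -- The three modalities of HLSQ; the duals of A ⊸ _ and !x are A ⊗ _
  -- and ∃x respectively.
  module Tens (A : Q) = Modality (A ⊸_) (S6 A) (λ d → S7 A d)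
  module Ex (x : Var) = Modality (!̇ x) (Q7 x) (λ d → Q8 x d)
  module Univ (x : Var) = Modality (∀̇ x) (Q6 x) (λ d → MP↣ (Q8 x d) (Q5 x _))

  ⊗-comm⇒ : Γ ⊢ ((A ⊗ B) ↣ (B ⊗ A))
  ⊗-comm⇒ {A = A} {B = B} = contra (S5 B A)

  ⊗-comm : (A ⊗ B) ≅ (B ⊗ A)
  ⊗-comm = ⊗-comm⇒ , ⊗-comm⇒

  ⊗-monoʳ : [] ⊢ (B ↣ C) → Γ ⊢ ((A ⊗ B) ↣ (A ⊗ C))
  ⊗-monoʳ {A = A} d = Tens.◇-mono A d

  ⊗-monoˡ : [] ⊢ (A ↣ C) → Γ ⊢ ((A ⊗ B) ↣ (C ⊗ B))
  ⊗-monoˡ {B = B} d = ⊗-comm⇒ ∙ Tens.◇-mono B d ∙ ⊗-comm⇒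

  ⊗-cong : A ≅ C → B ≅ θ → (A ⊗ B) ≅ (C ⊗ θ)
  ⊗-cong (a , b) (c , d) = ⊗-monoˡ a ∙ ⊗-monoʳ c , ⊗-monoʳ d ∙ ⊗-monoˡ b

  ⊗-congʳ : B ≅ C → (A ⊗ B) ≅ (A ⊗ C)
  ⊗-congʳ = ⊗-cong ≅-refl

  ⊗-swap : (A ⊗ (B ⊗ C)) ≅ (B ⊗ (A ⊗ C))
  ⊗-swap = swap , swap
    where
    swap : ∀ {A B C} → [] ⊢ ((A ⊗ (B ⊗ C)) ↣ (B ⊗ (A ⊗ C)))
    swap {A} {B} {C} = contra (Tens.□-mono B dne ∙ S4 B A (∼ C) ∙ Tens.□-mono A dni)

  ⊗-assoc : ((A ⊗ B) ⊗ C) ≅ (A ⊗ (B ⊗ C))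
  ⊗-assoc = ⊗-comm ≅∘ ⊗-swap ≅∘ ⊗-congʳ ⊗-comm

  ⊗-distribʳ-∨ : ((A ∨ B) ⊗ C) ≅ ((A ⊗ C) ∨ (B ⊗ C))
  ⊗-distribʳ-∨ {C = C} = ⊗-comm ≅∘ Tens.◇-distrib-∨ C ≅∘ ∨-cong ⊗-comm ⊗-comm

  ∧⊗⇒⊗ : Γ ⊢ ((φ ∧ (θ ⊗ χ)) ↣ (φ ⊗ χ))
  ∧⊗⇒⊗ {φ = φ} {θ = θ} {χ = χ} = ⟶I (⟶E (contra (⟶E (S3 φ (∼ χ) θ) (∧E₁ h0))) (∧E₂ h0))

  ⊗-fo : (fo α ⊗ fo β) ≅ fo (α ∨ᶠ β)
  ⊗-fo {α = α} {β = β} = ⋈⇒≅ (S1 α β)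

  ⊸≅∼⊗∼ : (φ ⊸ ψ) ≅ (∼ (φ ⊗ (∼ ψ)))
  ⊸≅∼⊗∼ {φ = φ} = Tens.□-cong φ (≅-sym ~~≅) ≅∘ ≅-sym ~~≅

  !≅∼∃∼ : ∀ x → !̇ x φ ≅ (∼ ∃̇ x (∼ φ))
  !≅∼∃∼ x = Ex.□-cong x (≅-sym ~~≅) ≅∘ ≅-sym ~~≅

  -- ∀x distributes over ↣: Q6 one way; the other by cases on ∀xφ, using
  -- Q1 when ∀xφ fails.
  ∀-distrib-↣ : ∀ x → ∀̇ x (φ ↣ ψ) ≅ (∀̇ x φ ↣ ∀̇ x ψ)
  ∀-distrib-↣ {φ = φ} {ψ = ψ} x = Q6 x φ ψ , ⟶I (cases holds fails)
    where
    holds : ((∀̇ x φ ↣ ∀̇ x ψ) ∷ []) ⊢ (∀̇ x φ ↣ ∀̇ x (φ ↣ ψ))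
    holds = ⟶I (⟶E (Univ.□-mono x (L1 ψ φ)) (⟶E h1 h0))
    fails : ((∀̇ x φ ↣ ∀̇ x ψ) ∷ []) ⊢ ((∼ ∀̇ x φ) ↣ ∀̇ x (φ ↣ ψ))
    fails = ⟶I (⟶E (Univ.□-mono x (⟶I (⟶I (efq h1 h0)))) (⟶E (∧E₂ (Q1 x φ)) h0))

  -- Team-level constants.  ⊥̇ is refutable; NonEmpty says the team is
  -- nonempty; Some ε that ε holds somewhere; Full ε that ε holds
  -- everywhere in a nonempty team.
  ⊥̇ : Q
  ⊥̇ = ∼ fo ⊤ᶠ

  ⊢∼⊥̇ : [] ⊢ (∼ ⊥̇)
  ⊢∼⊥̇ = ⟶E dni (embed ⊢⊤ᶠ)

  NonEmpty : Q
  NonEmpty = ∼ fo ⊥ᶠ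

  Some : FO → Q
  Some ε = ∼ fo (¬ᶠ ε)

  Full : FO → Q
  Full ε = fo ε ∧ NonEmpty

  ⊗-zeroˡ : (⊥̇ ⊗ X) ≅ ⊥̇
  ⊗-zeroˡ {X = X} = ⊗-comm⇒ ∙ Tens.◇-refutable X ⊢∼⊥̇ , ⟶I (efq (closed ⊢∼⊥̇) h0)

  ⊗-zeroʳ : (X ⊗ ⊥̇) ≅ ⊥̇
  ⊗-zeroʳ {X = X} = Tens.◇-refutable X ⊢∼⊥̇ , ⟶I (efq (closed ⊢∼⊥̇) h0)

  -- Some ε absorbs tensor factors (axiom S2: flat formulas are preserved).
  Some-absorbʳ : Γ ⊢ ((ψ ⊗ Some ε) ↣ Some ε)
  Some-absorbʳ {ψ = ψ} {ε = ε} = contra (S2 (¬ᶠ ε) ψ ∙ Tens.□-mono ψ dni)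

  Some-absorbˡ : Γ ⊢ ((Some ε ⊗ ψ) ↣ Some ε)
  Some-absorbˡ = ⊗-comm⇒ ∙ Some-absorbʳ

  Full⇒Some : Γ ⊢ (Full ε ↣ Some ε)
  Full⇒Some {ε = ε} = ⟶I (raa¬ (⟶E (⟶E (foImp₂ clash) (∧E₁ h1)) h0) (∧E₂ h1))
    where
    clash : [] ⊢ᶠ (ε ⇒ ((¬ᶠ ε) ⇒ ⊥ᶠ))
    clash = FP.⟶I (FP.⟶I (FP.efq FP.h0 FP.h1))

  -- Splitting off a witness: if ψ holds and ε holds somewhere, the team
  -- splits into a part where ε holds fully and a part satisfying ψ.  The
  -- split is given by the valid ¬ε ∨ ε, i.e. fo ¬ε ⊗ fo ε (axiom S1).
  split-Full : [] ⊢ ((ψ ∧ Some ε) ↣ (Full ε ⊗ ψ))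
  split-Full {ψ = ψ} {ε = ε} = ⟶I (∨E parts fullPart emptyPart)
    where
    Γ₀ : List Q
    Γ₀ = (ψ ∧ Some ε) ∷ []
    excluded : Γ₀ ⊢ (fo (¬ᶠ ε) ⊗ fo ε)
    excluded = ⟶E (∧E₂ (S1 (¬ᶠ ε) ε)) (embed FP.dne)
    fullOrEmpty : [] ⊢ (fo ε ↣ (Full ε ∨ fo ⊥ᶠ))
    fullOrEmpty = ⟶I (⟶I (raa (∧I h2 h0) h1))
    parts : Γ₀ ⊢ ((fo (¬ᶠ ε) ⊗ Full ε) ∨ (fo (¬ᶠ ε) ⊗ fo ⊥ᶠ))
    parts = ⟶E (closed (proj₁ (Tens.◇-distrib-∨ (fo (¬ᶠ ε))))) (⟶E (⊗-monoʳ fullOrEmpty) excluded)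
    fullPart : ((fo (¬ᶠ ε) ⊗ Full ε) ∷ Γ₀) ⊢ (Full ε ⊗ ψ)
    fullPart = ⟶E ⊗-comm⇒ (⟶E ∧⊗⇒⊗ (∧I (∧E₁ h1) h0))
    ¬ε∨⊥ : [] ⊢ᶠ (((¬ᶠ ε) ∨ᶠ ⊥ᶠ) ⇒ (¬ᶠ ε))
    ¬ε∨⊥ = FP.∨E⇒ FP.⟶-refl (FP.⟶I (FP.efq (FP.closed ⊢¬⊥ᶠ) FP.h0))
    emptyPart : ((fo (¬ᶠ ε) ⊗ fo ⊥ᶠ) ∷ Γ₀) ⊢ (Full ε ⊗ ψ)
    emptyPart = efq (∧E₂ h1) (⟶E (foImp ¬ε∨⊥) (⟶E (∧E₁ (S1 (¬ᶠ ε) ⊥ᶠ)) h0))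

  AllSome : List FO → Q
  AllSome [] = ∼ ⊥̇
  AllSome (ε ∷ εs) = Some ε ∧ AllSome εs

  ConjForm : FO → List FO → Q
  ConjForm α εs = fo α ∧ AllSome εs

  Fulls⊗ : List FO → Q → Q
  Fulls⊗ [] Z = Z
  Fulls⊗ (ε ∷ εs) Z = Full ε ⊗ Fulls⊗ εs Z

  TensorForm : FO → List FO → Q
  TensorForm α εs = Fulls⊗ εs (fo α)

  Below : FO → List FO → Set
  Below α = All (λ ε → [] ⊢ᶠ (ε ⇒ α))

  AllSome-absorb : ∀ εs → Γ ⊢ ((ψ ⊗ AllSome εs) ↣ AllSome εs)
  AllSome-absorb [] = ⟶I (closed ⊢∼⊥̇)
  AllSome-absorb (ε ∷ εs) =
    ⟶I (∧I (⟶E Some-absorbʳ (⟶E (⊗-monoʳ ∧E₁⇒) h0)) (⟶E (AllSome-absorb εs) (⟶E (⊗-monoʳ ∧E₂⇒) h0)))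

  -- A part satisfying some ε below α can be merged back (S1: ε ∨ α ⇒ α).
  ConjForm-absorb : ∀ εs → [] ⊢ᶠ (ε ⇒ α) → Γ ⊢ ((fo ε ⊗ ConjForm α εs) ↣ ConjForm α εs)
  ConjForm-absorb {ε = ε} {α = α} εs ε⇒α =
    ⟶I (∧I (⟶E (foImp (FP.∨E⇒ ε⇒α FP.⟶-refl)) (⟶E (∧E₁ (S1 ε α)) (⟶E (⊗-monoʳ ∧E₁⇒) h0)))
           (⟶E (AllSome-absorb εs) (⟶E (⊗-monoʳ ∧E₂⇒) h0)))

  conj≅tensor : ∀ εs → Below α εs → ConjForm α εs ≅ TensorForm α εs
  conj≅tensor [] [] = ∧-identityʳ ⊢∼⊥̇
  conj≅tensor {α = α} (ε ∷ εs) (ε⇒α ∷ below) = split , merge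
    where
    IH : ConjForm α εs ≅ TensorForm α εs
    IH = conj≅tensor εs below
    split : [] ⊢ (ConjForm α (ε ∷ εs) ↣ TensorForm α (ε ∷ εs))
    split = ⟶I (⟶E (⊗-monoʳ (proj₁ IH)) (⟶E (closed split-Full) (∧I (∧I (∧E₁ h0) (∧E₂ (∧E₂ h0))) (∧E₁ (∧E₂ h0)))))
    some : (TensorForm α (ε ∷ εs) ∷ []) ⊢ Some ε
    some = ⟶E Some-absorbˡ (⟶E (⊗-monoˡ Full⇒Some) h0)
    rest : (TensorForm α (ε ∷ εs) ∷ []) ⊢ ConjForm α εs
    rest = ⟶E (ConjForm-absorb εs ε⇒α) (⟶E (⊗-monoʳ (proj₂ IH)) (⟶E (⊗-monoˡ ∧E₁⇒) h0))
    merge : [] ⊢ (TensorForm α (ε ∷ εs) ↣ ConjForm α (ε ∷ εs))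
    merge = ⟶I (∧I (∧E₁ rest) (∧I some (∧E₂ rest)))

  Fulls⊗-cong : ∀ εs → Z ≅ Y → Fulls⊗ εs Z ≅ Fulls⊗ εs Y
  Fulls⊗-cong [] p = p
  Fulls⊗-cong (ε ∷ εs) p = ⊗-congʳ (Fulls⊗-cong εs p)

  Fulls⊗-⊗ˡ : ∀ εs → (Fulls⊗ εs Z ⊗ Y) ≅ Fulls⊗ εs (Z ⊗ Y)
  Fulls⊗-⊗ˡ [] = ≅-refl
  Fulls⊗-⊗ˡ (ε ∷ εs) = ⊗-assoc ≅∘ ⊗-congʳ (Fulls⊗-⊗ˡ εs)

  Fulls⊗-⊗ʳ : ∀ εs → (Z ⊗ Fulls⊗ εs Y) ≅ Fulls⊗ εs (Z ⊗ Y)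
  Fulls⊗-⊗ʳ [] = ≅-refl
  Fulls⊗-⊗ʳ (ε ∷ εs) = ⊗-swap ≅∘ ⊗-congʳ (Fulls⊗-⊗ʳ εs)

  Fulls⊗-++ : ∀ εs δs → Fulls⊗ (εs ++ δs) Z ≅ Fulls⊗ εs (Fulls⊗ δs Z)
  Fulls⊗-++ [] δs = ≅-refl
  Fulls⊗-++ (ε ∷ εs) δs = ⊗-congʳ (Fulls⊗-++ εs δs)

  TensorForm-⊗ : ∀ εs δs → (TensorForm α εs ⊗ TensorForm β δs) ≅ TensorForm (α ∨ᶠ β) (εs ++ δs)
  TensorForm-⊗ εs δs =
    Fulls⊗-⊗ˡ εs ≅∘ Fulls⊗-cong εs (Fulls⊗-⊗ʳ δs ≅∘ Fulls⊗-cong δs ⊗-fo) ≅∘ ≅-sym (Fulls⊗-++ εs δs)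

  -- Nonemptiness commutes with ∃x: the empty team is characterised by the
  -- closed formula ⊥ᶠ, which is invariant under ∀x and ∃x (Q4, Q2).
  ∃-NonEmpty : ∀ x → Γ ⊢ (∃̇ x NonEmpty ↣ NonEmpty)
  ∃-NonEmpty x = contra (foImp (⊥ᶠ⇒∀⊥ᶠ x) ∙ Q4 x ⊥ᶠ ∙ Ex.□-mono x dni)

  NonEmpty-! : ∀ x → Γ ⊢ (NonEmpty ↣ !̇ x NonEmpty)
  NonEmpty-! x = dni ∙ contra (closed ∃empty) ∙ dne ∙ Ex.□-mono x dne
    where
    ∃empty : [] ⊢ (∃̇ x (∼ NonEmpty) ↣ (∼ NonEmpty))
    ∃empty = Ex.◇-mono x dne ∙ ∧E₁ (Q2 x ⊥ᶠ) ∙ foImp (∃⊥ᶠ⇒⊥ᶠ x) ∙ dni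

  -- ∃x of a full part: by Q2 on the flat component and □◇⇒◇∧ to keep
  -- nonemptiness under !x.
  ∃-Full : ∀ x → ∃̇ x (Full ε) ≅ Full (∃ᶠ x ε)
  ∃-Full {ε = ε} x =
      ⟶I (∧I (⟶E (∧E₁ (Q2 x ε)) (⟶E (Ex.◇-mono x ∧E₁⇒) h0)) (⟶E (∃-NonEmpty x) (⟶E (Ex.◇-mono x ∧E₂⇒) h0)))
    , ⟶I (⟶E (Ex.◇-mono x (proj₁ ∧-comm)) (⟶E (Ex.□◇⇒◇∧ x) (∧I (⟶E (NonEmpty-! x) (∧E₂ h0)) (⟶E (∧E₂ (Q2 x ε)) (∧E₁ h0)))))

  ∃-TensorForm : ∀ x εs → ∃̇ x (TensorForm α εs) ≅ TensorForm (∃ᶠ x α) (map (∃ᶠ x) εs)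
  ∃-TensorForm {α = α} x [] = ⋈⇒≅ (Q2 x α)
  ∃-TensorForm {α = α} x (ε ∷ εs) = ⋈⇒≅ (Q3 x (Full ε) (TensorForm α εs)) ≅∘ ⊗-cong (∃-Full x) (∃-TensorForm x εs)

  Some-restrict : Γ ⊢ (fo γ ↣ (Some ε ↣ Some (γ ∧ᶠ ε)))
  Some-restrict {γ = γ} {ε = ε} = ⟶I (⟶I (raa¬ (⟶E (⟶E (foImp₂ γ⇒¬γε⇒¬ε) h2) h0) h1))
    where
    γ⇒¬γε⇒¬ε : [] ⊢ᶠ (γ ⇒ ((¬ᶠ (γ ∧ᶠ ε)) ⇒ (¬ᶠ ε)))
    γ⇒¬γε⇒¬ε = FP.⟶I (FP.⟶I (FP.raa¬ (FP.∧I FP.h2 FP.h0) FP.h1))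

  Some-unrestrict : Γ ⊢ (Some (γ ∧ᶠ ε) ↣ Some ε)
  Some-unrestrict = contra (foImp (FP.contra FP.∧E₂⇒))

  AllSome-restrict : ∀ εs → Γ ⊢ (fo γ ↣ (AllSome εs ↣ AllSome (map (γ ∧ᶠ_) εs)))
  AllSome-restrict [] = ⟶I ⟶-refl
  AllSome-restrict (ε ∷ εs) =
    ⟶I (⟶I (∧I (⟶E (⟶E Some-restrict h1) (∧E₁ h0)) (⟶E (⟶E (AllSome-restrict εs) h1) (∧E₂ h0))))

  AllSome-unrestrict : ∀ γ εs → Γ ⊢ (AllSome (map (γ ∧ᶠ_) εs) ↣ AllSome εs)
  AllSome-unrestrict γ [] = ⟶-refl
  AllSome-unrestrict γ (ε ∷ εs) = ⟶I (∧I (⟶E Some-unrestrict (∧E₁ h0)) (⟶E (AllSome-unrestrict γ εs) (∧E₂ h0)))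

  ConjForm-restrict : ∀ γ εs → ConjForm γ εs ≅ ConjForm γ (map (γ ∧ᶠ_) εs)
  ConjForm-restrict γ εs = ⟶I (∧I (∧E₁ h0) (⟶E (⟶E (AllSome-restrict εs) (∧E₁ h0)) (∧E₂ h0)))
                         , ⟶I (∧I (∧E₁ h0) (⟶E (AllSome-unrestrict γ εs) (∧E₂ h0)))

  AllSome-++ : ∀ εs δs → AllSome (εs ++ δs) ≅ (AllSome εs ∧ AllSome δs)
  AllSome-++ [] δs = ⟶I (∧I (closed ⊢∼⊥̇) h0) , ∧E₂⇒
  AllSome-++ (ε ∷ εs) δs = ∧-cong ≅-refl (AllSome-++ εs δs) ≅∘ ≅-sym ∧-assoc

  fo-∧ : (fo α ∧ fo β) ≅ fo (α ∧ᶠ β)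
  fo-∧ = ⟶I (⟶E (⟶E (foImp₂ (FP.⟶I (FP.⟶I (FP.∧I FP.h1 FP.h0)))) (∧E₁ h0)) (∧E₂ h0))
       , ⟶I (∧I (⟶E (foImp FP.∧E₁⇒) h0) (⟶E (foImp FP.∧E₂⇒) h0))

  record Disjunct : Set where
    constructor disjunct
    field
      base      : FO
      witnesses : List FO
      below     : Below base witnesses
  open Disjunct

  ⟪_⟫ : Disjunct → Q
  ⟪ c ⟫ = ConjForm (base c) (witnesses c)

  -- The tensor of disjuncts, computed on tensor shapes: bases are joined
  -- by ∨ᶠ and witness lists concatenated.
  _⊗ᵈ_ : Disjunct → Disjunct → Disjunct
  disjunct α εs ε⇒α ⊗ᵈ disjunct β δs δ⇒β =
    disjunct (α ∨ᶠ β) (εs ++ δs) (++⁺ (All.map (FP._∙ FP.∨I₁⇒) ε⇒α) (All.map (FP._∙ FP.∨I₂⇒) δ⇒β))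

  ⊗ᵈ-sound : ∀ c d → ⟪ c ⊗ᵈ d ⟫ ≅ (⟪ c ⟫ ⊗ ⟪ d ⟫)
  ⊗ᵈ-sound c@(disjunct α εs ε⇒α) d@(disjunct β δs δ⇒β) =
    conj≅tensor (εs ++ δs) (below (c ⊗ᵈ d))
      ≅∘ ≅-sym (⊗-cong (conj≅tensor εs ε⇒α) (conj≅tensor δs δ⇒β) ≅∘ TensorForm-⊗ εs δs)

  ∃ᵈ : Var → Disjunct → Disjunct
  ∃ᵈ x (disjunct α εs ε⇒α) = disjunct (∃ᶠ x α) (map (∃ᶠ x) εs) (gmap⁺ (∃-monoᶠ x) ε⇒α)

  ∃ᵈ-sound : ∀ x c → ⟪ ∃ᵈ x c ⟫ ≅ ∃̇ x ⟪ c ⟫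
  ∃ᵈ-sound x c@(disjunct α εs ε⇒α) =
    conj≅tensor (map (∃ᶠ x) εs) (below (∃ᵈ x c))
      ≅∘ ≅-sym (Ex.◇-cong x (conj≅tensor εs ε⇒α) ≅∘ ∃-TensorForm x εs)

  _∧ᵈ_ : Disjunct → Disjunct → Disjunct
  disjunct α εs _ ∧ᵈ disjunct β δs _ =
    disjunct (α ∧ᶠ β) (map ((α ∧ᶠ β) ∧ᶠ_) (εs ++ δs)) (map⁺ (All.universal (λ _ → FP.∧E₁⇒) (εs ++ δs)))

  ∧ᵈ-sound : ∀ c d → ⟪ c ∧ᵈ d ⟫ ≅ (⟪ c ⟫ ∧ ⟪ d ⟫)
  ∧ᵈ-sound (disjunct α εs _) (disjunct β δs _) =
    ≅-sym (∧-interchange ≅∘ ∧-cong fo-∧ (≅-sym (AllSome-++ εs δs)) ≅∘ ConjForm-restrict (α ∧ᶠ β) (εs ++ δs))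

  DNF : Set
  DNF = List Disjunct

  ⟦_⟧ : DNF → Q
  ⟦ [] ⟧ = ⊥̇
  ⟦ c ∷ D ⟧ = ⟪ c ⟫ ∨ ⟦ D ⟧

  ⟦++⟧ : ∀ D E → ⟦ D ++ E ⟧ ≅ (⟦ D ⟧ ∨ ⟦ E ⟧)
  ⟦++⟧ [] E = ≅-sym (∨-identityˡ ⊢∼⊥̇)
  ⟦++⟧ (c ∷ D) E = ∨-cong ≅-refl (⟦++⟧ D E) ≅∘ ≅-sym ∨-assoc

  module Distributive (_⋆_ : Q → Q → Q) (_⋆ᵈ_ : Disjunct → Disjunct → Disjunct)
    (⋆ᵈ-sound : ∀ c d → ⟪ c ⋆ᵈ d ⟫ ≅ (⟪ c ⟫ ⋆ ⟪ d ⟫))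
    (zeroˡ : ∀ {X} → (⊥̇ ⋆ X) ≅ ⊥̇)
    (zeroʳ : ∀ {X} → (X ⋆ ⊥̇) ≅ ⊥̇)
    (distribˡ : ∀ {X Y Z} → (X ⋆ (Y ∨ Z)) ≅ ((X ⋆ Y) ∨ (X ⋆ Z)))
    (distribʳ : ∀ {X Y Z} → ((Y ∨ Z) ⋆ X) ≅ ((Y ⋆ X) ∨ (Z ⋆ X))) where

    _⋆ᴰ_ : DNF → DNF → DNF
    [] ⋆ᴰ E = []
    (c ∷ D) ⋆ᴰ E = map (c ⋆ᵈ_) E ++ (D ⋆ᴰ E)

    map-sound : ∀ c E → ⟦ map (c ⋆ᵈ_) E ⟧ ≅ (⟪ c ⟫ ⋆ ⟦ E ⟧)
    map-sound c [] = ≅-sym zeroʳ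
    map-sound c (d ∷ E) = ∨-cong (⋆ᵈ-sound c d) (map-sound c E) ≅∘ ≅-sym distribˡ

    ⋆ᴰ-sound : ∀ D E → ⟦ D ⋆ᴰ E ⟧ ≅ (⟦ D ⟧ ⋆ ⟦ E ⟧)
    ⋆ᴰ-sound [] E = ≅-sym zeroˡ
    ⋆ᴰ-sound (c ∷ D) E =
      ⟦++⟧ (map (c ⋆ᵈ_) E) (D ⋆ᴰ E) ≅∘ ∨-cong (map-sound c E) (⋆ᴰ-sound D E) ≅∘ ≅-sym distribʳ

  module ConjDNF = Distributive _∧_ _∧ᵈ_ ∧ᵈ-sound (∧-zeroˡ ⊢∼⊥̇) (∧-zeroʳ ⊢∼⊥̇) ∧-distribˡ-∨ ∧-distribʳ-∨
  module TensDNF = Distributive _⊗_ _⊗ᵈ_ ⊗ᵈ-sound ⊗-zeroˡ ⊗-zeroʳ (λ {X} → Tens.◇-distrib-∨ X) ⊗-distribʳ-∨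

  -- Negation: ∼(α ∧ ⋀ Some εᵢ) is Some ¬α ∨ ⋁ ¬εᵢ, a DNF of single disjuncts.
  plainᵈ : FO → Disjunct
  plainᵈ α = disjunct α [] []

  plainᵈ-sound : ∀ α → ⟪ plainᵈ α ⟫ ≅ fo α
  plainᵈ-sound α = ∧-identityʳ ⊢∼⊥̇

  someᵈ : FO → Disjunct
  someᵈ ε = disjunct ⊤ᶠ (ε ∷ []) (FP.⟶E (H1ᶠ ⊤ᶠ ε) ⊢⊤ᶠ ∷ [])

  someᵈ-sound : ∀ ε → ⟪ someᵈ ε ⟫ ≅ Some ε
  someᵈ-sound ε = ⟶I (∧E₁ (∧E₂ h0)) , ⟶I (∧I (embed ⊢⊤ᶠ) (∧I h0 (closed ⊢∼⊥̇)))

  ¬AllSome : ∀ εs → ⟦ map (λ ε → plainᵈ (¬ᶠ ε)) εs ⟧ ≅ (∼ AllSome εs)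
  ¬AllSome [] = ≅-sym ~~≅
  ¬AllSome (ε ∷ εs) = ∨-cong (plainᵈ-sound (¬ᶠ ε) ≅∘ ≅-sym ~~≅) (¬AllSome εs) ≅∘ ≅-sym deMorgan-∧

  ¬ᵈ : Disjunct → DNF
  ¬ᵈ (disjunct α εs _) = someᵈ (¬ᶠ α) ∷ map (λ ε → plainᵈ (¬ᶠ ε)) εs

  ¬ᵈ-sound : ∀ c → ⟦ ¬ᵈ c ⟧ ≅ (∼ ⟪ c ⟫)
  ¬ᵈ-sound (disjunct α εs _) = ∨-cong (someᵈ-sound (¬ᶠ α) ≅∘ ¬¬α) (¬AllSome εs) ≅∘ ≅-sym deMorgan-∧
    where
    ¬¬α : Some (¬ᶠ α) ≅ (∼ fo α)
    ¬¬α = ~-cong (foImp FP.dne , foImp FP.dni)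

  ¬ᴰ : DNF → DNF
  ¬ᴰ [] = plainᵈ ⊤ᶠ ∷ []
  ¬ᴰ (c ∷ D) = ¬ᵈ c ConjDNF.⋆ᴰ ¬ᴰ D

  ¬ᴰ-sound : ∀ D → ⟦ ¬ᴰ D ⟧ ≅ (∼ ⟦ D ⟧)
  ¬ᴰ-sound [] = ∨-identityʳ ⊢∼⊥̇ ≅∘ ∧-comm ≅∘ ∧-identityʳ (embed ⊢⊤ᶠ)
  ¬ᴰ-sound (c ∷ D) = ConjDNF.⋆ᴰ-sound (¬ᵈ c) (¬ᴰ D) ≅∘ ∧-cong (¬ᵈ-sound c) (¬ᴰ-sound D) ≅∘ ≅-sym deMorgan-∨

  ∃ᴰ-sound : ∀ x D → ⟦ map (∃ᵈ x) D ⟧ ≅ ∃̇ x ⟦ D ⟧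
  ∃ᴰ-sound x [] = ⟶I (efq (closed ⊢∼⊥̇) h0) , Ex.◇-refutable x ⊢∼⊥̇
  ∃ᴰ-sound x (c ∷ D) = ∨-cong (∃ᵈ-sound x c) (∃ᴰ-sound x D) ≅∘ ≅-sym (Ex.◇-distrib-∨ x)

  ∧-isB : IsB φ → IsB ψ → IsB (φ ∧ ψ)
  ∧-isB p q = isNeg (isImp p (isNeg q))

  ∨-isB : IsB φ → IsB ψ → IsB (φ ∨ ψ)
  ∨-isB p q = isImp (isNeg p) q

  AllSome-isB : ∀ εs → IsB (AllSome εs)
  AllSome-isB [] = isNeg (isNeg (isFO ⊤ᶠ))
  AllSome-isB (ε ∷ εs) = ∧-isB (isNeg (isFO (¬ᶠ ε))) (AllSome-isB εs)

  ⟦⟧-isB : ∀ D → IsB ⟦ D ⟧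
  ⟦⟧-isB [] = isNeg (isFO ⊤ᶠ)
  ⟦⟧-isB (c ∷ D) = ∨-isB (∧-isB (isFO (base c)) (AllSome-isB (witnesses c))) (⟦⟧-isB D)

  HasB : Q → Set
  HasB φ = Σ Q (λ b → IsB b × (φ ≅ b))

  HasDNF : Q → Set
  HasDNF φ = Σ DNF (λ D → φ ≅ ⟦ D ⟧)

  B-resp : φ ≅ ψ → HasB ψ → HasB φ
  B-resp e (b , isB , ψ≅b) = b , isB , e ≅∘ ψ≅b

  DNF-resp : φ ≅ ψ → HasDNF ψ → HasDNF φ
  DNF-resp e (D , ψ≅D) = D , e ≅∘ ψ≅D

  ∼-DNF : HasDNF φ → HasDNF (∼ φ)
  ∼-DNF (D , φ≅D) = ¬ᴰ D , ~-cong φ≅D ≅∘ ≅-sym (¬ᴰ-sound D)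

  ↣-DNF : HasDNF φ → HasDNF ψ → HasDNF (φ ↣ ψ)
  ↣-DNF p (E , ψ≅E) with ∼-DNF p
  ... | D , ∼φ≅D = D ++ E , ⟶≅∨ ≅∘ ∨-cong ∼φ≅D ψ≅E ≅∘ ≅-sym (⟦++⟧ D E)

  ⊗-DNF : HasDNF φ → HasDNF ψ → HasDNF (φ ⊗ ψ)
  ⊗-DNF (D , φ≅D) (E , ψ≅E) = D TensDNF.⋆ᴰ E , ⊗-cong φ≅D ψ≅E ≅∘ ≅-sym (TensDNF.⋆ᴰ-sound D E)

  ∃-DNF : ∀ x → HasDNF φ → HasDNF (∃̇ x φ)
  ∃-DNF x (D , φ≅D) = map (∃ᵈ x) D , Ex.◇-cong x φ≅D ≅∘ ≅-sym (∃ᴰ-sound x D)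

  dnf : IsB φ → HasDNF φ
  dnf (isFO α) = plainᵈ α ∷ [] , ≅-sym (∨-identityʳ ⊢∼⊥̇ ≅∘ plainᵈ-sound α)
  dnf (isNeg p) = ∼-DNF (dnf p)
  dnf (isImp p q) = ↣-DNF (dnf p) (dnf q)

  toDNF : HasB φ → HasDNF φ
  toDNF (b , isB , φ≅b) = DNF-resp φ≅b (dnf isB)

  fromDNF : HasDNF φ → HasB φ
  fromDNF (D , φ≅D) = ⟦ D ⟧ , ⟦⟧-isB D , φ≅D

  ∼-B : HasB φ → HasB (∼ φ)
  ∼-B (b , isB , φ≅b) = ∼ b , isNeg isB , ~-cong φ≅b

  ↣-B : HasB φ → HasB ψ → HasB (φ ↣ ψ)
  ↣-B (b , isB , φ≅b) (c , isC , ψ≅c) = (b ↣ c) , isImp isB isC , ⟶-cong φ≅b ψ≅c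

  ⊗-B : HasB φ → HasB ψ → HasB (φ ⊗ ψ)
  ⊗-B p q = fromDNF (⊗-DNF (toDNF p) (toDNF q))

  ∃-B : ∀ x → HasB φ → HasB (∃̇ x φ)
  ∃-B x p = fromDNF (∃-DNF x (toDNF p))

  ∀-isB : ∀ x → IsB φ → HasB (∀̇ x φ)
  ∀-isB x (isFO α) = fo (∀ᶠ x α) , isFO (∀ᶠ x α) , ≅-refl
  ∀-isB x (isNeg {φ} p) = B-resp (⋈⇒≅ (Q1 x φ)) (∼-B (∀-isB x p))
  ∀-isB x (isImp p q) = B-resp (∀-distrib-↣ x) (↣-B (∀-isB x p) (∀-isB x q))

  ∀-B : ∀ x → HasB φ → HasB (∀̇ x φ)
  ∀-B x (b , isB , φ≅b) = B-resp (Univ.□-cong x φ≅b) (∀-isB x isB)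

  fromFO : ∀ α → HasB (fo α)
  fromFO α = fo α , isFO α , ≅-refl

  normalForm : (φ : Q) → HasB φ
  normalForm (eqQ t u) = fromFO (t ≐ u)
  normalForm (relQ R ts) = fromFO (rel R ts)
  normalForm (negQ α) = fromFO (¬ᶠ α)
  normalForm (impQ α β) = fromFO (α ⇒ β)
  normalForm (∼ φ) = ∼-B (normalForm φ)
  normalForm (φ ↣ ψ) = ↣-B (normalForm φ) (normalForm ψ)
  normalForm (φ ⊸ ψ) = B-resp ⊸≅∼⊗∼ (∼-B (⊗-B (normalForm φ) (∼-B (normalForm ψ))))
  normalForm (∀̇ x φ) = ∀-B x (normalForm φ)
  normalForm (!̇ x φ) = B-resp (!≅∼∃∼ x) (∼-B (∃-B x (∼-B (normalForm φ))))

theorem71 : (τ : Vocabulary) → (φ : Syntax.Q τ) →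
    Σ (Syntax.Q τ) (λ ψ → Syntax.IsB τ ψ × Syntax._⊣⊢_ τ φ ψ)
theorem71 τ φ with NormalForm.normalForm τ φ
... | ψ , ψ-isB , φ≅ψ = ψ , ψ-isB , NormalForm.≅⇒⊣⊢ τ φ≅ψ
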